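{- Let $G$ be a connected graph that is $K_4$-UH, is not the line graph of any simple graph, and is the edge-disjoint union of subgraphs isomorphic to $K_4$. Let $H=G\,\square\,G$ be the Cartesian square of $G$. Then: (a) $H$ is connected; (b) $H$ is not a line graph; (c) $H$ is the edge-disjoint union of subgraphs isomorphic to $K_4$; (d) $H$ is $K_4$-UH.
   Context: A graph $G$ is $K_4$-UH if every isomorphism between two induced subgraphs of $G$ isomorphic to $K_4$ extends to an automorphism of $G$. The Cartesian product $G\,\square\,G$ has vertex set $V(G)\times V(G)$, with $(u,v)$ adjacent to $(u',v')$ iff either $u=u'$ and $vv'\in E(G)$, or $v=v'$ and $uu'\in E(G)$. -}

module Defs where

open import Data.Bool using (Bool; true; false; _∧_; _∨_)
open import Data.Nat using (ℕ)
open import Data.Fin using (Fin; _<_)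
open import Data.Product using (Σ; Σ-syntax; ∃; ∃-syntax; _×_; _,_; proj₁; proj₂)
open import Data.Sum using (_⊎_)
open import Data.Empty using (⊥-elim)
open import Relation.Binary.PropositionalEquality using (_≡_; _≢_; refl; sym; cong₂)
open import Relation.Binary.Definitions using (DecidableEquality)
open import Relation.Binary.Construct.Closure.ReflexiveTransitive using (Star)
open import Relation.Nullary using (does; yes; no)
open import Function.Bundles using (_↔_; Inverse; _⇔_)

record Graph : Set₁ where
  field
    Vertex  : Set
    _≟_     : DecidableEquality Vertex
    adj     : Vertex → Vertex → Bool
    adj-sym : ∀ u v → adj u v ≡ adj v u
    adj-irr : ∀ u → adj u u ≡ false

open Graph public

Adj : (G : Graph) → Vertex G → Vertex G → Set
Adj G u v = adj G u v ≡ true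

Finite : Graph → Set
Finite G = Σ[ n ∈ ℕ ] (Vertex G ↔ Fin n)

Connected : Graph → Set
Connected G = ∀ u v → Star (Adj G) u v

record Automorphism (G : Graph) : Set where
  field
    perm     : Vertex G ↔ Vertex G
    preserve : ∀ u v → adj G u v ≡ adj G (Inverse.to perm u) (Inverse.to perm v)

-- Any induced subgraph isomorphic to K₄ is the image
-- of such a map, and any isomorphism between two induced K₄'s is
-- a i ↦ b i for suitable orderings a, b.
IsK4 : (G : Graph) → (Fin 4 → Vertex G) → Set
IsK4 G a = ∀ i j → i ≢ j → Adj G (a i) (a j)

K4-UH : Graph → Set
K4-UH G = ∀ (a b : Fin 4 → Vertex G) → IsK4 G a → IsK4 G b →
  Σ[ φ ∈ Automorphism G ] (∀ i → Inverse.to (Automorphism.perm φ) (a i) ≡ b i)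

_∈K_ : {V : Set} → V → (Fin 4 → V) → Set
v ∈K c = ∃[ k ] c k ≡ v

K4-Decomposable : Graph → Set₁
K4-Decomposable G =
  Σ[ I ∈ Set ] Σ[ c ∈ (I → Fin 4 → Vertex G) ]
    ((∀ i → IsK4 G (c i)) ×
     (∀ u v → Adj G u v →
        (∃[ i ] (u ∈K c i × v ∈K c i)) ×
        (∀ i j → u ∈K c i → v ∈K c i → u ∈K c j → v ∈K c j → i ≡ j)))

-- Edges of a simple graph Γ on vertex set Fin m with adjacency γ,
-- each edge {u,v} represented uniquely by u < v.
Edge : (m : ℕ) → (Fin m → Fin m → Bool) → Set
Edge m γ = Σ[ u ∈ Fin m ] Σ[ v ∈ Fin m ] (u < v × γ u v ≡ true)

ends₁ ends₂ : ∀ {m γ} → Edge m γ → Fin m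
ends₁ (u , _ , _) = u
ends₂ (_ , v , _) = v

ShareEnd : ∀ {m γ} → Edge m γ → Edge m γ → Set
ShareEnd e f = (ends₁ e ≡ ends₁ f ⊎ ends₁ e ≡ ends₂ f) ⊎ (ends₂ e ≡ ends₁ f ⊎ ends₂ e ≡ ends₂ f)

LineAdj : ∀ {m γ} → Edge m γ → Edge m γ → Set
LineAdj e f = e ≢ f × ShareEnd e f

IsLineGraph : Graph → Set
IsLineGraph G =
  Σ[ m ∈ ℕ ] Σ[ γ ∈ (Fin m → Fin m → Bool) ]
    ((∀ u v → γ u v ≡ γ v u) × (∀ u → γ u u ≡ false) ×
     Σ[ f ∈ (Vertex G ↔ Edge m γ) ]
       (∀ x y → Adj G x y ⇔ LineAdj (Inverse.to f x) (Inverse.to f y)))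

□-≟ : (G H : Graph) → DecidableEquality (Vertex G × Vertex H)
□-≟ G H (u , v) (u' , v') with _≟_ G u u' | _≟_ H v v'
... | yes refl | yes refl = yes refl
... | no p     | _        = no λ { refl → p refl }
... | yes _    | no q     = no λ { refl → q refl }

□-adj : (G H : Graph) → Vertex G × Vertex H → Vertex G × Vertex H → Bool
□-adj G H (u , v) (u' , v') =
  (does (_≟_ G u u') ∧ adj H v v') ∨ (does (_≟_ H v v') ∧ adj G u u')

private
  does-sym : {A : Set} (d : DecidableEquality A) (x y : A) → does (d x y) ≡ does (d y x)
  does-sym d x y with d x y | d y x
  ... | yes _ | yes _ = refl
  ... | no _  | no _  = refl
  ... | yes p | no q  = ⊥-elim (q (sym p))
  ... | no p  | yes q = ⊥-elim (p (sym q))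

  does-refl : {A : Set} (d : DecidableEquality A) (x : A) → does (d x x) ≡ true
  does-refl d x with d x x
  ... | yes _ = refl
  ... | no p  = ⊥-elim (p refl)

□-sym : (G H : Graph) → ∀ p q → □-adj G H p q ≡ □-adj G H q p
□-sym G H (u , v) (u' , v')
  rewrite does-sym (_≟_ G) u u' | does-sym (_≟_ H) v v'
        | adj-sym H v v' | adj-sym G u u' = refl

□-irr : (G H : Graph) → ∀ p → □-adj G H p p ≡ false
□-irr G H (u , v)
  rewrite does-refl (_≟_ G) u | does-refl (_≟_ H) v
        | adj-irr H v | adj-irr G u = refl

_□_ : Graph → Graph → Graph
G □ H = record
  { Vertex  = Vertex G × Vertex H
  ; _≟_     = □-≟ G H
  ; adj     = □-adj G H
  ; adj-sym = □-sym G H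
  ; adj-irr = □-irr G H
  }

-- Every edge of G □ G lies in a copy {x} × G or G × {y} of G, so walks, the K₄ decomposition
-- and K₄'s themselves come from G layer by layer: a triangle of G □ G cannot use both
-- coordinates.  Given K₄'s a and b, swapping coordinates if necessary puts them in layers
-- {x} × G and {y} × G; K₄-ultrahomogeneity of G maps the one K₄ onto the other inside the
-- layer, and an automorphism σ of G with σ x = y moves the layer.  Such σ exists because
-- every vertex of G lies in a K₄ of the decomposition (G is connected) and G is K₄-UH.
-- For (b), G ≅ G × {v₀} is an induced subgraph of G □ G, and an induced subgraph of the
-- line graph of Γ is the line graph of the subgraph of Γ formed by the edges it uses.
-- The empty graph is a line graph, so G has a vertex v₀; finiteness is used only to find it.

module Submission where

open import Axiom.UniquenessOfIdentityProofs using (module Decidable⇒UIP)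
open import Data.Bool using (Bool; true; false; _∧_; _∨_; T)
import Data.Bool.Properties as Bool
open import Data.Empty using (⊥-elim)
open import Data.Fin using (Fin; zero; suc; _<_)
open import Data.Fin.Permutation using (Permutation′; transpose; _⟨$⟩ʳ_)
open import Data.Fin.Properties using (_<?_; <-irrefl; <-asym; <-irrelevant; ¬Fin0)
open import Data.Nat using (ℕ)
open import Data.Product using (Σ-syntax; ∃-syntax; _×_; _,_; proj₁; proj₂; map₁; swap)
open import Data.Product.Algebra using (×-comm)
open import Data.Product.Properties using (Σ-≡,≡→≡)
open import Data.Sum using (_⊎_; inj₁; inj₂)
open import Defs
open import Function using (_∘_)
open import Function.Bundles using (_↔_; Inverse; _⇔_; mk↔ₛ′; mk⇔; Equivalence; Injection)
open import Function.Construct.Composition using (_↔-∘_; _⇔-∘_)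
open import Function.Construct.Identity using (↔-id)
open import Function.Construct.Symmetry using (↔-sym)
open import Function.Definitions using (Injective)
open import Function.Properties.Inverse using (↔⇒↣)
open import Relation.Binary.Construct.Closure.ReflexiveTransitive using (Star; ε; _◅_; _◅◅_; gmap)
open import Relation.Binary.Definitions using (DecidableEquality)
open import Relation.Binary.PropositionalEquality
  using (_≡_; _≢_; refl; sym; trans; cong; cong₂; subst₂; module ≡-Reasoning)
open import Relation.Nullary using (¬_; Dec; yes; no; does; isYes)
open import Relation.Nullary.Decidable
  using (True; toWitness; fromWitness; map′; dec-true; dec-false; dec-yes-irr; _×-dec_)

does-≟-injective : {A B : Set} (_≟ᴬ_ : DecidableEquality A) (_≟ᴮ_ : DecidableEquality B)
  {f : A → B} → Injective _≡_ _≡_ f → ∀ x y → does (x ≟ᴬ y) ≡ does (f x ≟ᴮ f y)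
does-≟-injective _≟ᴬ_ _≟ᴮ_ {f} f-inj x y with x ≟ᴬ y
... | yes refl = sym (dec-true (f x ≟ᴮ f x) refl)
... | no x≢y   = sym (dec-false (f x ≟ᴮ f y) (x≢y ∘ f-inj))

∨-≡-true : ∀ a {b} → a ∨ b ≡ true → a ≡ true ⊎ b ≡ true
∨-≡-true true  _ = inj₁ refl
∨-≡-true false b = inj₂ b

∧-≡-true : ∀ a {b} → a ∧ b ≡ true → a ≡ true × b ≡ true
∧-≡-true true b = refl , b

does⇒≡ : ∀ {A : Set} {x y : A} (x≟y : Dec (x ≡ y)) → does x≟y ≡ true → x ≡ y
does⇒≡ (yes x≡y) _ = x≡y

module _ (G : Graph) where

  adj-irrefl : ∀ {x} → ¬ Adj G x x
  adj-irrefl {x} xx with () ← trans (sym xx) (adj-irr G x)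

  adj⇒≢ : ∀ {x y} → Adj G x y → x ≢ y
  adj⇒≢ xy refl = adj-irrefl xy

  walk-start : ∀ {x z} → Star (Adj G) x z → x ≢ z → ∃[ y ] Adj G x y
  walk-start ε       x≢x = ⊥-elim (x≢x refl)
  walk-start (xy ◅ _) _  = _ , xy

  no-isolated-vertex : Connected G → ∀ {u v} → Adj G u v → ∀ x → ∃[ y ] Adj G x y
  no-isolated-vertex conn {u} {v} uv x with _≟_ G x u
  ... | yes refl = v , uv
  ... | no x≢u   = walk-start (conn x u) x≢u

module _ (G H : Graph) where

  □-adjˡ : ∀ {u u'} v → Adj G u u' → Adj (G □ H) (u , v) (u' , v)
  □-adjˡ {u} {u'} v uu' rewrite dec-true (_≟_ H v v) refl | uu' = Bool.∨-zeroʳ _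

  □-adjʳ : ∀ u {v v'} → Adj H v v' → Adj (G □ H) (u , v) (u , v')
  □-adjʳ u {v} {v'} vv' rewrite dec-true (_≟_ G u u) refl | vv' = refl

  □-adj-cases : ∀ {u u' v v'} → Adj (G □ H) (u , v) (u' , v') →
    (u ≡ u' × Adj H v v') ⊎ (v ≡ v' × Adj G u u')
  □-adj-cases {u} {u'} {v} {v'} a with ∨-≡-true (does (_≟_ G u u') ∧ adj H v v') a
  ... | inj₁ uv = let u≟u' , vv' = ∧-≡-true _ uv in inj₁ (does⇒≡ (_≟_ G u u') u≟u' , vv')
  ... | inj₂ uv = let v≟v' , uu' = ∧-≡-true _ uv in inj₂ (does⇒≡ (_≟_ H v v') v≟v' , uu')

  □-connected : Connected G → Connected H → Connected (G □ H)
  □-connected conn-G conn-H (u , v) (u' , v') =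
    gmap (_, v) (□-adjˡ v) (conn-G u u') ◅◅ gmap (u' ,_) (□-adjʳ u') (conn-H v v')

  □-triangle₁ : ∀ {x y z} → Adj (G □ H) x y → Adj (G □ H) x z → Adj (G □ H) y z →
    proj₁ x ≡ proj₁ y → proj₁ x ≡ proj₁ z
  □-triangle₁ xy xz yz x≡y with □-adj-cases xz | □-adj-cases yz
  ... | inj₁ (x≡z , _) | _              = x≡z
  ... | inj₂ _         | inj₁ (y≡z , _) = trans x≡y y≡z
  ... | inj₂ (x≡z , _) | inj₂ (y≡z , _) =
    ⊥-elim (adj⇒≢ (G □ H) xy (cong₂ _,_ x≡y (trans x≡z (sym y≡z))))

  □-triangle₂ : ∀ {x y z} → Adj (G □ H) x y → Adj (G □ H) x z → Adj (G □ H) y z →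
    proj₂ x ≡ proj₂ y → proj₂ x ≡ proj₂ z
  □-triangle₂ xy xz yz x≡y with □-adj-cases xz | □-adj-cases yz
  ... | inj₂ (x≡z , _) | _              = x≡z
  ... | inj₁ _         | inj₂ (y≡z , _) = trans x≡y y≡z
  ... | inj₁ (x≡z , _) | inj₁ (y≡z , _) =
    ⊥-elim (adj⇒≢ (G □ H) xy (cong₂ _,_ (trans x≡z (sym y≡z)) x≡y))

  data K4-Layer (a : Fin 4 → Vertex (G □ H)) : Set where
    H-layer : ∀ x {c} → IsK4 H c → (∀ i → a i ≡ (x , c i)) → K4-Layer a
    G-layer : ∀ y {c} → IsK4 G c → (∀ i → a i ≡ (c i , y)) → K4-Layer a

  □-K4-proj₂ : ∀ {a} → IsK4 (G □ H) a → (∀ i → proj₁ (a zero) ≡ proj₁ (a i)) → IsK4 H (proj₂ ∘ a)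
  □-K4-proj₂ a-K4 same i j i≢j with □-adj-cases (a-K4 i j i≢j)
  ... | inj₁ (_ , aᵢaⱼ) = aᵢaⱼ
  ... | inj₂ (_ , aᵢaⱼ) = ⊥-elim (adj-irrefl G (subst₂ (Adj G) (sym (same i)) (sym (same j)) aᵢaⱼ))

  □-K4-proj₁ : ∀ {a} → IsK4 (G □ H) a → (∀ i → proj₂ (a zero) ≡ proj₂ (a i)) → IsK4 G (proj₁ ∘ a)
  □-K4-proj₁ a-K4 same i j i≢j with □-adj-cases (a-K4 i j i≢j)
  ... | inj₂ (_ , aᵢaⱼ) = aᵢaⱼ
  ... | inj₁ (_ , aᵢaⱼ) = ⊥-elim (adj-irrefl H (subst₂ (Adj H) (sym (same i)) (sym (same j)) aᵢaⱼ))

  □-K4-layer : ∀ {a} → IsK4 (G □ H) a → K4-Layer a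
  □-K4-layer {a} a-K4 with □-adj-cases (a-K4 zero (suc zero) λ ())
  ... | inj₁ (a₀≡a₁ , _) =
    H-layer (proj₁ (a zero)) (□-K4-proj₂ a-K4 fixed) (λ i → cong (_, proj₂ (a i)) (sym (fixed i)))
    where
    fixed : ∀ i → proj₁ (a zero) ≡ proj₁ (a i)
    fixed zero          = refl
    fixed (suc zero)    = a₀≡a₁
    fixed (suc (suc i)) =
      □-triangle₁ (a-K4 zero (suc zero) λ ()) (a-K4 zero _ λ ()) (a-K4 (suc zero) _ λ ()) a₀≡a₁
  ... | inj₂ (a₀≡a₁ , _) =
    G-layer (proj₂ (a zero)) (□-K4-proj₁ a-K4 fixed) (λ i → cong (proj₁ (a i) ,_) (sym (fixed i)))
    where
    fixed : ∀ i → proj₂ (a zero) ≡ proj₂ (a i)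
    fixed zero          = refl
    fixed (suc zero)    = a₀≡a₁
    fixed (suc (suc i)) =
      □-triangle₂ (a-K4 zero (suc zero) λ ()) (a-K4 zero _ λ ()) (a-K4 (suc zero) _ λ ()) a₀≡a₁

  □-K4-decomposable : K4-Decomposable G → K4-Decomposable H → K4-Decomposable (G □ H)
  □-K4-decomposable (I , c , c-K4 , c-cover) (J , d , d-K4 , d-cover) = Copy , copy , copy-K4 , cover
    where
    Copy : Set
    Copy = (I × Vertex H) ⊎ (Vertex G × J)

    copy : Copy → Fin 4 → Vertex (G □ H)
    copy (inj₁ (i , v)) k = c i k , v
    copy (inj₂ (u , j)) k = u , d j k

    copy-K4 : ∀ α → IsK4 (G □ H) (copy α)
    copy-K4 (inj₁ (i , v)) k l k≢l = □-adjˡ v (c-K4 i k l k≢l)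
    copy-K4 (inj₂ (u , j)) k l k≢l = □-adjʳ u (d-K4 j k l k≢l)

    H-edge-copy : ∀ {u v v'} → v ≢ v' → ∀ α → (u , v) ∈K copy α → (u , v') ∈K copy α →
      Σ[ j ∈ J ] (α ≡ inj₂ (u , j) × v ∈K d j × v' ∈K d j)
    H-edge-copy v≢v' (inj₁ _) (_ , e) (_ , e') =
      ⊥-elim (v≢v' (trans (sym (cong proj₂ e)) (cong proj₂ e')))
    H-edge-copy _ (inj₂ (_ , j)) (k , e) (k' , e') =
      j , cong (λ u → inj₂ (u , j)) (cong proj₁ e) , (k , cong proj₂ e) , (k' , cong proj₂ e')

    G-edge-copy : ∀ {u u' v} → u ≢ u' → ∀ α → (u , v) ∈K copy α → (u' , v) ∈K copy α →
      Σ[ i ∈ I ] (α ≡ inj₁ (i , v) × u ∈K c i × u' ∈K c i)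
    G-edge-copy _ (inj₁ (i , _)) (k , e) (k' , e') =
      i , cong (λ v → inj₁ (i , v)) (cong proj₂ e) , (k , cong proj₁ e) , (k' , cong proj₁ e')
    G-edge-copy u≢u' (inj₂ _) (_ , e) (_ , e') =
      ⊥-elim (u≢u' (trans (sym (cong proj₁ e)) (cong proj₁ e')))

    cover : ∀ p q → Adj (G □ H) p q →
      (∃[ α ] (p ∈K copy α × q ∈K copy α)) ×
      (∀ α β → p ∈K copy α → q ∈K copy α → p ∈K copy β → q ∈K copy β → α ≡ β)
    cover (u , v) (u' , v') pq with □-adj-cases pq
    ... | inj₁ (refl , vv') =
      let (j , (k , dk) , (k' , dk')) , unique = d-cover v v' vv' in
      (inj₂ (u , j) , (k , cong (u ,_) dk) , (k' , cong (u ,_) dk')) , λ α β pα qα pβ qβ →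
        let j₁ , α≡ , vj₁ , v'j₁ = H-edge-copy (adj⇒≢ H vv') α pα qα
            j₂ , β≡ , vj₂ , v'j₂ = H-edge-copy (adj⇒≢ H vv') β pβ qβ
        in trans α≡ (trans (cong (λ j → inj₂ (u , j)) (unique j₁ j₂ vj₁ v'j₁ vj₂ v'j₂)) (sym β≡))
    ... | inj₂ (refl , uu') =
      let (i , (k , ck) , (k' , ck')) , unique = c-cover u u' uu' in
      (inj₁ (i , v) , (k , cong (_, v) ck) , (k' , cong (_, v) ck')) , λ α β pα qα pβ qβ →
        let i₁ , α≡ , ui₁ , u'i₁ = G-edge-copy (adj⇒≢ G uu') α pα qα
            i₂ , β≡ , ui₂ , u'i₂ = G-edge-copy (adj⇒≢ G uu') β pβ qβ
        in trans α≡ (trans (cong (λ i → inj₁ (i , v)) (unique i₁ i₂ ui₁ u'i₁ ui₂ u'i₂)) (sym β≡))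

module _ {G : Graph} where

  apply : Automorphism G → Vertex G → Vertex G
  apply φ = Inverse.to (Automorphism.perm φ)

  unapply : Automorphism G → Vertex G → Vertex G
  unapply φ = Inverse.from (Automorphism.perm φ)

  apply-injective : (φ : Automorphism G) → Injective _≡_ _≡_ (apply φ)
  apply-injective φ = Injection.injective (↔⇒↣ (Automorphism.perm φ))

  unapply-apply : (φ : Automorphism G) → ∀ x → unapply φ (apply φ x) ≡ x
  unapply-apply φ = Inverse.strictlyInverseʳ (Automorphism.perm φ)

  apply-unapply : (φ : Automorphism G) → ∀ x → apply φ (unapply φ x) ≡ x
  apply-unapply φ = Inverse.strictlyInverseˡ (Automorphism.perm φ)

  idᴬ : Automorphism G
  idᴬ = record { perm = ↔-id (Vertex G) ; preserve = λ _ _ → refl }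

  infixr 9 _∘ᴬ_
  _∘ᴬ_ : Automorphism G → Automorphism G → Automorphism G
  φ ∘ᴬ ψ = record
    { perm     = Automorphism.perm φ ↔-∘ Automorphism.perm ψ
    ; preserve = λ u v → trans (Automorphism.preserve ψ u v) (Automorphism.preserve φ _ _)
    }

  _⁻¹ᴬ : Automorphism G → Automorphism G
  φ ⁻¹ᴬ = record
    { perm     = ↔-sym (Automorphism.perm φ)
    ; preserve = λ u v → sym (trans (Automorphism.preserve φ (unapply φ u) (unapply φ v))
                                    (cong₂ (adj G) (apply-unapply φ u) (apply-unapply φ v)))
    }

VertexTransitive : Graph → Set
VertexTransitive G = ∀ x y → Σ[ φ ∈ Automorphism G ] apply φ x ≡ y

module _ {G H : Graph} where

  _□ᴬ_ : Automorphism G → Automorphism H → Automorphism (G □ H)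
  σ □ᴬ τ = record
    { perm     = mk↔ₛ′ (λ (u , v) → apply σ u , apply τ v) (λ (u , v) → unapply σ u , unapply τ v)
                       (λ (u , v) → cong₂ _,_ (apply-unapply σ u) (apply-unapply τ v))
                       (λ (u , v) → cong₂ _,_ (unapply-apply σ u) (unapply-apply τ v))
    ; preserve = λ (u , v) (u' , v') →
        cong₂ _∨_ (cong₂ _∧_ (does-≟-injective (_≟_ G) (_≟_ G) (apply-injective σ) u u') (Automorphism.preserve τ v v'))
                  (cong₂ _∧_ (does-≟-injective (_≟_ H) (_≟_ H) (apply-injective τ) v v') (Automorphism.preserve σ u u'))
    }

swapᴬ : (G : Graph) → Automorphism (G □ G)
swapᴬ G = record
  { perm     = ×-comm (Vertex G) (Vertex G)
  ; preserve = λ (u , v) (u' , v') → Bool.∨-comm (does (_≟_ G u u') ∧ adj G v v') _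
  }

K4-Through : (G : Graph) → Vertex G → Set
K4-Through G x = Σ[ c ∈ (Fin 4 → Vertex G) ] (IsK4 G c × c zero ≡ x)

module _ (G : Graph) where

  IsK4-relabel : ∀ {c} → IsK4 G c → (π : Permutation′ 4) → IsK4 G (c ∘ (π ⟨$⟩ʳ_))
  IsK4-relabel c-K4 π i j i≢j = c-K4 _ _ (i≢j ∘ Injection.injective (↔⇒↣ π))

  K4-through-edge : K4-Decomposable G → ∀ {x y} → Adj G x y → K4-Through G x
  K4-through-edge (_ , c , c-K4 , cover) xy with proj₁ (cover _ _ xy)
  ... | i , (k , cₖ≡x) , _ = c i ∘ (transpose zero k ⟨$⟩ʳ_) , IsK4-relabel (c-K4 i) (transpose zero k) , cₖ≡x

  K4-through-every-vertex : Connected G → K4-Decomposable G → ∀ {u v} → Adj G u v → ∀ x → K4-Through G x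
  K4-through-every-vertex conn decomp uv x = K4-through-edge decomp (proj₂ (no-isolated-vertex G conn uv x))

  K4-UH⇒vertex-transitive : K4-UH G → (∀ x → K4-Through G x) → VertexTransitive G
  K4-UH⇒vertex-transitive uh through x y with through x | through y
  ... | c , c-K4 , refl | d , d-K4 , refl = let φ , φc≡d = uh c d c-K4 d-K4 in φ , φc≡d zero

  □-K4-to-H-layer : ∀ {a} → IsK4 (G □ G) a →
    Σ[ ρ ∈ Automorphism (G □ G) ] Σ[ x ∈ Vertex G ] Σ[ c ∈ (Fin 4 → Vertex G) ]
      (IsK4 G c × ∀ i → apply ρ (a i) ≡ (x , c i))
  □-K4-to-H-layer a-K4 with □-K4-layer G G a-K4
  ... | H-layer x c-K4 a≡ = idᴬ , x , _ , c-K4 , a≡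
  ... | G-layer y c-K4 a≡ = swapᴬ G , y , _ , c-K4 , λ i → cong swap (a≡ i)

  □-K4-UH : (∀ {d} → IsK4 G d → VertexTransitive G) → K4-UH G → K4-UH (G □ G)
  □-K4-UH transitive uh a b a-K4 b-K4
    with ρ , x , c , c-K4 , ρa ← □-K4-to-H-layer a-K4
       | ρ' , y , d , d-K4 , ρ'b ← □-K4-to-H-layer b-K4
    with σ , σx≡y ← transitive c-K4 x y
       | τ , τc≡d ← uh c d c-K4 d-K4
    = ρ' ⁻¹ᴬ ∘ᴬ (σ □ᴬ τ) ∘ᴬ ρ , λ i → begin
      unapply ρ' (apply (σ □ᴬ τ) (apply ρ (a i))) ≡⟨ cong (unapply ρ' ∘ apply (σ □ᴬ τ)) (ρa i) ⟩
      unapply ρ' (apply σ x , apply τ (c i))       ≡⟨ cong (unapply ρ') (cong₂ _,_ σx≡y (τc≡d i)) ⟩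
      unapply ρ' (y , d i)                          ≡⟨ cong (unapply ρ') (ρ'b i) ⟨
      unapply ρ' (apply ρ' (b i))                   ≡⟨ unapply-apply ρ' (b i) ⟩
      b i                                           ∎
    where open ≡-Reasoning

Link : ∀ {m} → (Fin m → Fin m → Bool) → Fin m → Fin m → Set
Link γ s t = s < t × γ s t ≡ true

link-irrelevant : ∀ {m γ} {s t : Fin m} (l l' : Link γ s t) → l ≡ l'
link-irrelevant (p , q) (p' , q') = cong₂ _,_ (<-irrelevant p p') (Decidable⇒UIP.≡-irrelevant Bool._≟_ q q')

edge-≡ : ∀ {m γ} (e f : Edge m γ) → ends₁ e ≡ ends₁ f → ends₂ e ≡ ends₂ f → e ≡ f
edge-≡ {γ = γ} (s , t , l) (.s , .t , l') refl refl = cong (λ l → s , t , l) (link-irrelevant {γ = γ} l l')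

module _ {m : ℕ} {γ : Fin m → Fin m → Bool} where

  link? : ∀ s t → Dec (Link γ s t)
  link? s t = (s <? t) ×-dec (γ s t Bool.≟ true)

  module _ (S : Edge m γ → Bool) where

    selected : Fin m → Fin m → Bool
    selected s t with link? s t
    ... | yes l = S (s , t , l)
    ... | no _  = false

    selected-sound : ∀ {s t} → T (selected s t) → Σ[ l ∈ Link γ s t ] T (S (s , t , l))
    selected-sound {s} {t} sel with link? s t
    ... | yes l = l , sel
    ... | no _  = ⊥-elim sel

    selected-complete : ∀ e → T (S e) → T (selected (ends₁ e) (ends₂ e))
    selected-complete (s , t , l) Se rewrite dec-yes-irr (link? s t) (link-irrelevant {γ = γ}) l = Se

    restrict : Fin m → Fin m → Bool
    restrict s t = selected s t ∨ selected t s

    restrict-sym : ∀ s t → restrict s t ≡ restrict t s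
    restrict-sym s t = Bool.∨-comm (selected s t) (selected t s)

    selected-< : ∀ {s t} → T (selected s t) → s < t
    selected-< = proj₁ ∘ proj₁ ∘ selected-sound

    restrict-irr : ∀ s → restrict s s ≡ false
    restrict-irr s with selected s s in sel
    ... | true  = ⊥-elim (<-irrefl refl (selected-< {s} (Equivalence.from Bool.T-≡ sel)))
    ... | false = refl

    restrict⇒selected : ∀ {s t} → s < t → restrict s t ≡ true → T (selected s t)
    restrict⇒selected s<t r with Equivalence.to Bool.T-∨ (Equivalence.from Bool.T-≡ r)
    ... | inj₁ sel = sel
    ... | inj₂ sel = ⊥-elim (<-asym s<t (selected-< sel))

    restrict-↔ : Edge m restrict ↔ (Σ[ e ∈ Edge m γ ] T (S e))
    restrict-↔ = mk↔ₛ′ to from to-from from-to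
      where
      to : Edge m restrict → Σ[ e ∈ Edge m γ ] T (S e)
      to (s , t , s<t , r) = let l , Se = selected-sound (restrict⇒selected s<t r) in (s , t , l) , Se

      from : Σ[ e ∈ Edge m γ ] T (S e) → Edge m restrict
      from (e , Se) = ends₁ e , ends₂ e , proj₁ (proj₂ (proj₂ e)) ,
        Equivalence.to Bool.T-≡ (Equivalence.from Bool.T-∨ (inj₁ (selected-complete e Se)))

      to-from : ∀ p → to (from p) ≡ p
      to-from (e , _) = Σ-≡,≡→≡ (edge-≡ _ e refl refl , Bool.T-irrelevant _ _)

      from-to : ∀ e → from (to e) ≡ e
      from-to e = edge-≡ _ e refl refl

module _ {A B : Set} {e : A → B} (e-injective : Injective _≡_ _≡_ e)
         (image? : ∀ y → Dec (∃[ x ] e x ≡ y)) where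

  image-↔ : A ↔ (Σ[ y ∈ B ] True (image? y))
  image-↔ = mk↔ₛ′ (λ x → e x , fromWitness (x , refl)) (λ (y , w) → proj₁ (toWitness w)) to-from from-to
    where
    to-from : ∀ p → (e (proj₁ (toWitness (proj₂ p))) , _) ≡ p
    to-from (y , w) = Σ-≡,≡→≡ (proj₂ (toWitness w) , Bool.T-irrelevant _ _)

    from-to : ∀ x → proj₁ (toWitness (fromWitness {a? = image? (e x)} (x , refl))) ≡ x
    from-to x = e-injective (proj₂ (toWitness (fromWitness {a? = image? (e x)} (x , refl))))

module _ {G L : Graph} {e : Vertex G → Vertex L} (e-injective : Injective _≡_ _≡_ e)
         (image? : ∀ y → Dec (∃[ x ] e x ≡ y)) (e-adj : ∀ x y → Adj G x y ⇔ Adj L (e x) (e y)) where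

  induced-line-graph : IsLineGraph L → IsLineGraph G
  induced-line-graph (m , γ , _ , _ , F , F-adj) =
    m , restrict S , restrict-sym S , restrict-irr S , g ,
    λ x y → line-adj x y ⇔-∘ (F-adj (e x) (e y) ⇔-∘ e-adj x y)
    where
    open Inverse F using (to; from; strictlyInverseˡ; strictlyInverseʳ)

    f : Vertex G → Edge m γ
    f = to ∘ e

    f-injective : Injective _≡_ _≡_ f
    f-injective = e-injective ∘ Injection.injective (↔⇒↣ F)

    f-image? : ∀ ed → Dec (∃[ x ] f x ≡ ed)
    f-image? ed = map′ (λ (x , ex≡) → x , trans (cong to ex≡) (strictlyInverseˡ ed))
                      (λ (x , fx≡) → x , trans (sym (strictlyInverseʳ (e x))) (cong from fx≡))
                      (image? (from ed))

    S : Edge m γ → Bool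
    S ed = isYes (f-image? ed)

    g : Vertex G ↔ Edge m (restrict S)
    g = ↔-sym (restrict-↔ S) ↔-∘ image-↔ f-injective f-image?

    -- g x and f x have the same ends, so only the inequality component needs transporting.
    line-adj : ∀ x y → LineAdj (f x) (f y) ⇔ LineAdj (Inverse.to g x) (Inverse.to g y)
    line-adj x y = mk⇔ (map₁ (λ fx≢fy → fx≢fy ∘ cong f ∘ Injection.injective (↔⇒↣ g)))
                       (map₁ (λ gx≢gy → gx≢gy ∘ cong (Inverse.to g) ∘ f-injective))

module _ (G : Graph) where

  empty-line-graph : ¬ Vertex G → IsLineGraph G
  empty-line-graph ¬x = 0 , (λ _ _ → false) , (λ _ _ → refl) , (λ _ → refl) ,
    mk↔ₛ′ (⊥-elim ∘ ¬x) (λ ()) (λ ()) (⊥-elim ∘ ¬x) , (λ x → ⊥-elim (¬x x))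

  inhabited : Finite G → ¬ IsLineGraph G → Vertex G
  inhabited (ℕ.zero , V↔Fin0) ¬line = ⊥-elim (¬line (empty-line-graph (¬Fin0 ∘ Inverse.to V↔Fin0)))
  inhabited (ℕ.suc _ , V↔Fin) _    = Inverse.from V↔Fin zero

module _ (G H : Graph) where

  □-not-line-graph : ¬ IsLineGraph G → Vertex H → ¬ IsLineGraph (G □ H)
  □-not-line-graph ¬line v₀ =
    ¬line ∘ induced-line-graph {G = G} {L = G □ H} {e = _, v₀} (cong proj₁) layer? layer-adj
    where
    layer? : ∀ p → Dec (∃[ x ] (x , v₀) ≡ p)
    layer? (u , v) = map′ (λ v₀≡v → u , cong (u ,_) v₀≡v) (cong proj₂ ∘ proj₂) (_≟_ H v₀ v)

    layer-adj : ∀ x y → Adj G x y ⇔ Adj (G □ H) (x , v₀) (y , v₀)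
    layer-adj x y = mk⇔ (□-adjˡ G H v₀) λ xy → case-G-edge (□-adj-cases G H xy)
      where
      case-G-edge : (x ≡ y × Adj H v₀ v₀) ⊎ (v₀ ≡ v₀ × Adj G x y) → Adj G x y
      case-G-edge (inj₁ (_ , v₀v₀)) = ⊥-elim (adj-irrefl H v₀v₀)
      case-G-edge (inj₂ (_ , xy))   = xy

theorem9 : (G : Graph) → Finite G → Connected G → K4-UH G → ¬ IsLineGraph G → K4-Decomposable G →
    Connected (G □ G) × ¬ IsLineGraph (G □ G) × K4-Decomposable (G □ G) × K4-UH (G □ G)
theorem9 G finite conn uh ¬line decomp =
  □-connected G G conn conn ,
  □-not-line-graph G G ¬line (inhabited G finite ¬line) ,
  □-K4-decomposable G G decomp decomp ,
  □-K4-UH G transitive uh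
  where
  transitive : ∀ {d} → IsK4 G d → VertexTransitive G
  transitive d-K4 = K4-UH⇒vertex-transitive G uh
    (K4-through-every-vertex G conn decomp (d-K4 zero (suc zero) λ ()))
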